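{- Let $G$ be a graph and $k$ a positive integer. Then $\gamma_k(G)\le \chi_{\mu_k}(G)$.
   Context: All graphs are finite, simple and undirected. $d_G(u,v)$ is the distance in $G$ (infinite if there is no $u,v$-path); a $u,v$-geodesic is a shortest $u,v$-path. For a positive integer $k$, a set $M\subseteq V(G)$ is a $k$-distance mutual-visibility set if for every two distinct $u,v\in M$ there is a $u,v$-geodesic of length at most $k$ none of whose internal vertices lies in $M$. The $k$-distance mutual-visibility chromatic number $\chi_{\mu_k}(G)$ is the minimum number of parts in a partition of $V(G)$ into $k$-distance mutual-visibility sets. A set $D\subseteq V(G)$ is a distance $k$-dominating set if every vertex of $V(G)\setminus D$ is at distance at most $k$ from some vertex of $D$; $\gamma_k(G)$ is the minimum cardinality of a distance $k$-dominating set. -}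

module Defs where

open import Data.Nat using (ℕ; zero; suc; _≤_)
open import Data.Fin using (Fin; _≟_)
open import Data.Vec using (tabulate)
open import Relation.Nullary.Decidable.Core using (does)
open import Data.Fin.Subset using (Subset; _∈_; _∉_; ∣_∣)
open import Data.Bool using (Bool; true; false)
open import Data.Product using (Σ; ∃; _×_; ∃-syntax)
open import Data.Unit using (⊤)
open import Relation.Binary.PropositionalEquality using (_≡_; _≢_)
open import Function.Definitions using (Surjective)

record Graph (n : ℕ) : Set where
  field
    adj    : Fin n → Fin n → Bool
    sym    : ∀ u v → adj u v ≡ adj v u
    irrefl : ∀ u → adj u u ≡ false

open Graph public

data Walk {n : ℕ} (G : Graph n) : Fin n → Fin n → ℕ → Set where
  []   : ∀ {u} → Walk G u u 0
  step : ∀ {u w v ℓ} → adj G u w ≡ true → Walk G w v ℓ → Walk G u v (suc ℓ)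

InternalAvoid : ∀ {n} {G : Graph n} {u v ℓ} → Subset n → Walk G u v ℓ → Set
InternalAvoid M [] = ⊤
InternalAvoid M (step _ []) = ⊤
InternalAvoid M (step {w = w} _ p@(step _ _)) = (w ∉ M) × InternalAvoid M p

IsGeodesic : ∀ {n} (G : Graph n) {u v ℓ} → Walk G u v ℓ → Set
IsGeodesic G {u} {v} {ℓ} _ = ∀ ℓ' → Walk G u v ℓ' → ℓ ≤ ℓ'

IsKDistMutVis : ∀ {n} (G : Graph n) (k : ℕ) → Subset n → Set
IsKDistMutVis G k M =
  ∀ u v → u ∈ M → v ∈ M → u ≢ v →
    Σ ℕ λ ℓ → Σ (Walk G u v ℓ) λ p → IsGeodesic G p × ℓ ≤ k × InternalAvoid M p

DistLe : ∀ {n} (G : Graph n) → Fin n → Fin n → ℕ → Set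
DistLe G u v k = Σ ℕ λ ℓ → Walk G u v ℓ × ℓ ≤ k

IsDistKDom : ∀ {n} (G : Graph n) (k : ℕ) → Subset n → Set
IsDistKDom G k D = ∀ v → v ∉ D → ∃[ u ] (u ∈ D × DistLe G u v k)

IsGammaK : ∀ {n} (G : Graph n) (k : ℕ) → ℕ → Set
IsGammaK G k g =
  (∃[ D ] (IsDistKDom G k D × ∣ D ∣ ≡ g)) × (∀ D → IsDistKDom G k D → g ≤ ∣ D ∣)

ColorClass : ∀ {n c} → (Fin n → Fin c) → Fin c → Subset n
ColorClass f i = tabulate (λ x → does (f x ≟ i))

-- partition of V(G) into exactly c (nonempty) k-distance mutual-visibility sets,
-- given as a surjective map assigning each vertex its part
IsMuKPartition : ∀ {n} (G : Graph n) (k c : ℕ) → (Fin n → Fin c) → Set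
IsMuKPartition G k c f = Surjective _≡_ _≡_ f × (∀ i → IsKDistMutVis G k (ColorClass f i))

IsChiMuK : ∀ {n} (G : Graph n) (k : ℕ) → ℕ → Set
IsChiMuK {n} G k c =
  (Σ (Fin n → Fin c) (IsMuKPartition G k c)) ×
  (∀ c' (f : Fin n → Fin c') → IsMuKPartition G k c' f → c ≤ c')

{-# OPTIONS --safe #-}
-- Choose one vertex from each of the c colour classes. The chosen set has at
-- most c elements, and every other vertex v is joined to the chosen vertex of
-- its own class by a geodesic of length at most k (the two are distinct
-- members of one k-distance mutual-visibility set), so the set is distance
-- k-dominating.
module Submission where

open import Defs hiding (sym)
open import Data.Nat using (ℕ; zero; suc; _+_; _≤_; NonZero; z≤n; s≤s)
open import Data.Nat.Properties using (≤-trans; ≤-reflexive; n≤1+n; +-suc; +-monoʳ-≤; module ≤-Reasoning)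
open import Data.Fin using (Fin; _≟_)
import Data.Fin as Fin
open import Data.Fin.Subset using (Subset; _∈_; ∣_∣; _∪_; ⁅_⁆; ⊥; inside; outside)
open import Data.Fin.Subset.Properties using (x∈⁅x⁆; ∣⁅x⁆∣≡1; ∣⊥∣≡0; x∈p∪q⁺)
open import Data.Vec using ([]; _∷_)
open import Data.Vec.Properties using (lookup⇒[]=; lookup∘tabulate)
open import Data.Product using (∃-syntax; _×_; _,_; proj₁; proj₂)
open import Data.Sum using (inj₁; inj₂)
open import Relation.Nullary.Decidable using (dec-true)
open import Relation.Binary.PropositionalEquality using (_≡_; _≢_; refl; sym; trans; cong)

∣p∪q∣≤∣p∣+∣q∣ : ∀ {n} (p q : Subset n) → ∣ p ∪ q ∣ ≤ ∣ p ∣ + ∣ q ∣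
∣p∪q∣≤∣p∣+∣q∣ []            []            = z≤n
∣p∪q∣≤∣p∣+∣q∣ (inside  ∷ p) (inside  ∷ q) =
  s≤s (≤-trans (∣p∪q∣≤∣p∣+∣q∣ p q) (+-monoʳ-≤ ∣ p ∣ (n≤1+n ∣ q ∣)))
∣p∪q∣≤∣p∣+∣q∣ (inside  ∷ p) (outside ∷ q) = s≤s (∣p∪q∣≤∣p∣+∣q∣ p q)
∣p∪q∣≤∣p∣+∣q∣ (outside ∷ p) (inside  ∷ q) =
  ≤-trans (s≤s (∣p∪q∣≤∣p∣+∣q∣ p q)) (≤-reflexive (sym (+-suc ∣ p ∣ ∣ q ∣)))
∣p∪q∣≤∣p∣+∣q∣ (outside ∷ p) (outside ∷ q) = ∣p∪q∣≤∣p∣+∣q∣ p q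

image : ∀ {m n} → (Fin m → Fin n) → Subset n
image {zero}  s = ⊥
image {suc m} s = ⁅ s Fin.zero ⁆ ∪ image (λ i → s (Fin.suc i))

∈-image : ∀ {m n} (s : Fin m → Fin n) i → s i ∈ image s
∈-image s Fin.zero    = x∈p∪q⁺ (inj₁ (x∈⁅x⁆ (s Fin.zero)))
∈-image s (Fin.suc i) = x∈p∪q⁺ (inj₂ (∈-image (λ j → s (Fin.suc j)) i))

∣image∣≤ : ∀ {m n} (s : Fin m → Fin n) → ∣ image s ∣ ≤ m
∣image∣≤ {zero}  {n} s = ≤-reflexive (∣⊥∣≡0 n)
∣image∣≤ {suc m}     s = begin
  ∣ ⁅ s Fin.zero ⁆ ∪ rest ∣     ≤⟨ ∣p∪q∣≤∣p∣+∣q∣ ⁅ s Fin.zero ⁆ rest ⟩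
  ∣ ⁅ s Fin.zero ⁆ ∣ + ∣ rest ∣ ≡⟨ cong (_+ ∣ rest ∣) (∣⁅x⁆∣≡1 (s Fin.zero)) ⟩
  suc ∣ rest ∣                  ≤⟨ s≤s (∣image∣≤ (λ i → s (Fin.suc i))) ⟩
  suc m                         ∎
  where
  open ≤-Reasoning
  rest : Subset _
  rest = image (λ i → s (Fin.suc i))

∈-ColorClass : ∀ {n c} (f : Fin n → Fin c) {x i} → f x ≡ i → x ∈ ColorClass f i
∈-ColorClass f {x} {i} fx≡i =
  lookup⇒[]= x _ (trans (lookup∘tabulate _ x) (dec-true (f x ≟ i) fx≡i))

meetsEveryClass⇒distKDom : ∀ {n c} (G : Graph n) (k : ℕ) (f : Fin n → Fin c) →
  (∀ i → IsKDistMutVis G k (ColorClass f i)) →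
  (D : Subset n) → (∀ v → ∃[ u ] (u ∈ D × f u ≡ f v)) → IsDistKDom G k D
meetsEveryClass⇒distKDom G k f vis D meets v v∉D with meets v
... | u , u∈D , fu≡fv with vis (f v) u v (∈-ColorClass f fu≡fv) (∈-ColorClass f refl) u≢v
  where
  u≢v : u ≢ v
  u≢v refl = v∉D u∈D
...   | ℓ , p , _ , ℓ≤k , _ = u , u∈D , ℓ , p , ℓ≤k

proposition2p3 : ∀ {n} (G : Graph n) (k : ℕ) → NonZero k →
    ∀ g c → IsGammaK G k g → IsChiMuK G k c → g ≤ c
proposition2p3 G k _ g c (_ , γ-minimal) ((f , f-surjective , vis) , _) =
  ≤-trans (γ-minimal D D-dominating) (∣image∣≤ representative)
  where
  representative : Fin c → Fin _
  representative i = proj₁ (f-surjective i)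

  D : Subset _
  D = image representative

  D-dominating : IsDistKDom G k D
  D-dominating = meetsEveryClass⇒distKDom G k f vis D λ v →
    representative (f v) , ∈-image representative (f v) , proj₂ (f-surjective (f v)) refl
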